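{- Let $a,b\ge1$ and $n\in\mathbb{N}$, and let $P$ be the $(a+b-1)$-fractal of dimension $n$, a pattern on the vertex set $\{0,\dots,(a+b-1)^n-1\}$. For every 2-coloring $c$ of these vertices, either there is a set of vertices all of $c$-color $0$ on which $P$ restricts (as a sub-pattern) to the $a$-fractal of dimension $n$, or there is a set of vertices all of $c$-color $1$ on which $P$ restricts to the $b$-fractal of dimension $n$.
   Context: A pattern of size $\ell$ is $p:[\ell]^2\to2$; its restriction to $\{i_0<\dots<i_{m-1}\}$ is the sub-pattern $q(s,t)=p(i_s,i_t)$. A permutation $\pi$ of $\{0,\dots,\ell-1\}$ is identified with the pattern $p_\pi(x,y)=0$ iff $\pi(x)<\pi(y)$. Direct sum $(\pi\oplus\sigma)(x)=\pi(x)$ for $x<m$, $\sigma(x-m)+m$ otherwise; skew sum $(\pi\ominus\sigma)(x)=\pi(x)+n'$ for $x<m$, $\sigma(x-m)$ otherwise ($m,n'$ sizes of $\pi,\sigma$). The $k$-fractal of dimension $0$ is the one-element permutation; the $k$-fractal of dimension $n+1$ is the direct sum of $k$ copies of the $k$-fractal of dimension $n$ if $n$ is even, and the skew sum of $k$ copies if $n$ is odd. -}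

module Defs where

open import Data.Nat using (ℕ; zero; suc; _+_; _*_; _^_; _<ᵇ_)
open import Data.Fin using (Fin; splitAt; _<_)
open import Data.Bool using (Bool; true; false; not)
open import Data.Sum using (inj₁; inj₂)
open import Relation.Binary.PropositionalEquality using (_≡_)

-- A pattern of size ℓ: p : [ℓ]² → 2, with 2 = Bool (0 = false, 1 = true).
Pattern : ℕ → Set
Pattern ℓ = Fin ℓ → Fin ℓ → Bool

Perm : ℕ → Set
Perm ℓ = Fin ℓ → ℕ

patternOf : ∀ {ℓ} → Perm ℓ → Pattern ℓ
patternOf π x y = not (π x <ᵇ π y)

_⊕_ : ∀ {m n} → Perm m → Perm n → Perm (m + n)
_⊕_ {m} {n} π σ x with splitAt m x
... | inj₁ i = π i
... | inj₂ j = σ j + m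

_⊖_ : ∀ {m n} → Perm m → Perm n → Perm (m + n)
_⊖_ {m} {n} π σ x with splitAt m x
... | inj₁ i = π i + n
... | inj₂ j = σ j

empty : Perm 0
empty ()

single : Perm 1
single _ = 0

directCopies : ∀ {s} (k : ℕ) → Perm s → Perm (k * s)
directCopies zero    π = empty
directCopies (suc k) π = π ⊕ directCopies k π

skewCopies : ∀ {s} (k : ℕ) → Perm s → Perm (k * s)
skewCopies zero    π = empty
skewCopies (suc k) π = π ⊖ skewCopies k π

isEven : ℕ → Bool
isEven zero    = true
isEven (suc n) = not (isEven n)

fractal : (k n : ℕ) → Perm (k ^ n)
fractal k zero    = single
fractal k (suc n) with isEven n
... | true  = directCopies k (fractal k n)
... | false = skewCopies k (fractal k n)

restrict : ∀ {ℓ m} → Pattern ℓ → (Fin m → Fin ℓ) → Pattern m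
restrict p f s t = p (f s) (f t)

StrictlyIncreasing : ∀ {m ℓ} → (Fin m → Fin ℓ) → Set
StrictlyIncreasing f = ∀ s t → s < t → f s < f t

MonoCopy : ∀ {ℓ m} → Pattern ℓ → (Fin ℓ → Bool) → Bool → Pattern m → Set
MonoCopy {ℓ} {m} p c col q =
  Data.Product.Σ (Fin m → Fin ℓ) λ f →
    StrictlyIncreasing f Data.Product.×
    ((s : Fin m) → c (f s) ≡ col) Data.Product.×
    ((s t : Fin m) → restrict p f s t ≡ q s t)
  where import Data.Product

-- The (a+b-1)-fractal of dimension n+1 is a sum of a+b-1 blocks, each
-- a copy of the fractal of dimension n, all arranged increasingly (n even) or decreasingly (n odd).
-- By induction every block contains a colour-0 copy of the a-fractal or a colour-1 copy of the
-- b-fractal of dimension n, and by pigeonhole a blocks of the first kind or b of the second exist.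
-- In a sum of copies the pattern inside a block is that of the block, and between two blocks it
-- depends only on their order; as the a- and b-fractals of dimension n+1 are sums of the same
-- kind, the selected copies, placed in the selected blocks, assemble into the required copy.
module Submission where

open import Defs
open import Data.Nat using (ℕ; zero; suc; _+_; _∸_; _*_; _^_; _≤_; _<_; _<ᵇ_; z≤n; s≤s)
open import Data.Nat.Properties
  using (+-comm; +-assoc; +-suc; +-monoʳ-<; *-monoˡ-≤; m≤m+n; m+n≤o⇒n≤o;
         <⇒≤; <-≤-trans; <-irrefl; <-asym; ≤-refl; ∸-monoʳ-<; module ≤-Reasoning)
open import Data.Fin using (Fin; zero; suc; toℕ; opposite; combine; remQuot; quotient; remainder)
  renaming (_<_ to _<ꟳ_)
open import Data.Fin.Properties
  using (splitAt-↑ˡ; splitAt-↑ʳ; toℕ-combine; combine-remQuot; combine-monoˡ-<; toℕ<n;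
         toℕ-fromℕ; toℕ-inject₁; opposite-prop; <-cmp)
open import Data.Bool using (Bool; true; false; not)
open import Data.Sum using (_⊎_; inj₁; inj₂; map)
open import Data.Product using (Σ; _×_; _,_; proj₁; proj₂; uncurry)
open import Data.Empty using (⊥-elim)
open import Function using (_∘_)
open import Relation.Binary.PropositionalEquality
open import Relation.Binary.Definitions using (tri<; tri≈; tri>)

<⇒<ᵇ≡true : ∀ {m n} → m < n → (m <ᵇ n) ≡ true
<⇒<ᵇ≡true {zero}  (s≤s _)   = refl
<⇒<ᵇ≡true {suc m} (s≤s m<n) = <⇒<ᵇ≡true m<n

≤⇒<ᵇ≡false : ∀ {m n} → n ≤ m → (m <ᵇ n) ≡ false
≤⇒<ᵇ≡false {n = zero}  z≤n       = refl
≤⇒<ᵇ≡false {n = suc n} (s≤s n≤m) = ≤⇒<ᵇ≡false n≤m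

+-cancelˡ-<ᵇ : ∀ o {m n} → (o + m <ᵇ o + n) ≡ (m <ᵇ n)
+-cancelˡ-<ᵇ zero    = refl
+-cancelˡ-<ᵇ (suc o) = +-cancelˡ-<ᵇ o

patternOf-< : ∀ {ℓ} (π : Perm ℓ) {x y} → π x < π y → patternOf π x y ≡ false
patternOf-< π lt = cong not (<⇒<ᵇ≡true lt)

patternOf-> : ∀ {ℓ} (π : Perm ℓ) {x y} → π y < π x → patternOf π x y ≡ true
patternOf-> π gt = cong not (≤⇒<ᵇ≡false (<⇒≤ gt))

offset-< : ∀ {s o o' u} → o < o' → u < s → o * s + u < o' * s
offset-< {s} {o} {o'} {u} o<o' u<s = begin-strict
  o * s + u  <⟨ +-monoʳ-< (o * s) u<s ⟩
  o * s + s  ≡⟨ +-comm (o * s) s ⟩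
  suc o * s  ≤⟨ *-monoˡ-≤ s o<o' ⟩
  o' * s     ∎
  where open ≤-Reasoning

opposite-anti-< : ∀ {k} {i j : Fin k} → i <ꟳ j → toℕ (opposite j) < toℕ (opposite i)
opposite-anti-< {k} {i} {j} i<j
  rewrite opposite-prop i | opposite-prop j = ∸-monoʳ-< (s≤s i<j) (toℕ<n j)

combine-monoʳ-< : ∀ {m n} (i : Fin m) {x y : Fin n} → x <ꟳ y → combine i x <ꟳ combine i y
combine-monoʳ-< {n = n} i {x} {y} x<y
  rewrite toℕ-combine i x | toℕ-combine i y = +-monoʳ-< (n * toℕ i) x<y

combine-<-lex : ∀ {m n} {i j : Fin m} {x y : Fin n}
  → combine i x <ꟳ combine j y → i <ꟳ j ⊎ (i ≡ j × x <ꟳ y)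
combine-<-lex {i = i} {j} {x} {y} lt with <-cmp i j
... | tri< i<j _ _ = inj₁ i<j
... | tri> _ _ j<i = ⊥-elim (<-asym lt (combine-monoˡ-< y x j<i))
... | tri≈ _ refl _ with <-cmp x y
...   | tri< x<y _ _ = inj₂ (refl , x<y)
...   | tri≈ _ refl _ = ⊥-elim (<-irrefl refl lt)
...   | tri> _ _ y<x = ⊥-elim (<-asym lt (combine-monoʳ-< i y<x))

directCopies-combine : ∀ {s} k (π : Perm s) (i : Fin k) (x : Fin s)
  → directCopies k π (combine i x) ≡ toℕ i * s + π x
directCopies-combine {s} (suc k) π zero x
  rewrite splitAt-↑ˡ s x (k * s) = refl
directCopies-combine {s} (suc k) π (suc i) x
  rewrite splitAt-↑ʳ s (k * s) (combine i x) | directCopies-combine k π i x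
  = trans (+-comm (toℕ i * s + π x) s) (sym (+-assoc s (toℕ i * s) (π x)))

skewCopies-combine : ∀ {s} k (π : Perm s) (i : Fin k) (x : Fin s)
  → skewCopies k π (combine i x) ≡ toℕ (opposite i) * s + π x
skewCopies-combine {s} (suc k) π zero x
  rewrite splitAt-↑ˡ s x (k * s) | toℕ-fromℕ k = +-comm (π x) (k * s)
skewCopies-combine {s} (suc k) π (suc i) x
  rewrite splitAt-↑ʳ s (k * s) (combine i x) | toℕ-inject₁ (opposite i)
  = skewCopies-combine k π i x

copies : ∀ {s} → Bool → (k : ℕ) → Perm s → Perm (k * s)
copies true  = directCopies
copies false = skewCopies

blockRank : ∀ {k} → Bool → Fin k → Fin k
blockRank true  i = i
blockRank false i = opposite i

copies-combine : ∀ {s} d k (π : Perm s) (i : Fin k) (x : Fin s)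
  → copies d k π (combine i x) ≡ toℕ (blockRank d i) * s + π x
copies-combine true  = directCopies-combine
copies-combine false = skewCopies-combine

Bounded : ∀ {s} → Perm s → Set
Bounded {s} π = ∀ x → π x < s

module _ {s} (π : Perm s) (bounded : Bounded π) where

  copies-block-< : ∀ d {k} {i j : Fin k} x y → toℕ (blockRank d i) < toℕ (blockRank d j)
    → copies d k π (combine i x) < copies d k π (combine j y)
  copies-block-< d {k} {i} {j} x y r<r' =
    subst₂ _<_ (sym (copies-combine d k π i x)) (sym (copies-combine d k π j y))
      (<-≤-trans (offset-< r<r' (bounded x)) (m≤m+n _ (π y)))

  copies-bounded : ∀ d k → Bounded (copies d k π)
  copies-bounded d k z =
    subst (λ w → copies d k π w < k * s) (combine-remQuot {k} s z)
      (subst (_< k * s) (sym (copies-combine d k π i x))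
        (offset-< (toℕ<n (blockRank d i)) (bounded x)))
    where
    i = quotient {k} s z
    x = remainder {k} s z

  copies-pattern-within : ∀ d k (i : Fin k) x y
    → patternOf (copies d k π) (combine i x) (combine i y) ≡ patternOf π x y
  copies-pattern-within d k i x y = begin
    not (copies d k π (combine i x) <ᵇ copies d k π (combine i y))
      ≡⟨ cong₂ (λ u v → not (u <ᵇ v)) (copies-combine d k π i x) (copies-combine d k π i y) ⟩
    not (toℕ (blockRank d i) * s + π x <ᵇ toℕ (blockRank d i) * s + π y)
      ≡⟨ cong not (+-cancelˡ-<ᵇ (toℕ (blockRank d i) * s)) ⟩
    patternOf π x y ∎
    where open ≡-Reasoning

  copies-pattern-before : ∀ d k {i j : Fin k} x y → i <ꟳ j
    → patternOf (copies d k π) (combine i x) (combine j y) ≡ not d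
  copies-pattern-before true  k x y i<j = patternOf-< (copies true k π) (copies-block-< true x y i<j)
  copies-pattern-before false k x y i<j =
    patternOf-> (copies false k π) (copies-block-< false y x (opposite-anti-< i<j))

  copies-pattern-after : ∀ d k {i j : Fin k} x y → j <ꟳ i
    → patternOf (copies d k π) (combine i x) (combine j y) ≡ d
  copies-pattern-after true  k x y j<i = patternOf-> (copies true k π) (copies-block-< true y x j<i)
  copies-pattern-after false k x y j<i =
    patternOf-< (copies false k π) (copies-block-< false x y (opposite-anti-< j<i))

Selection : ∀ {k} → (Fin k → Set) → ℕ → Set
Selection {k} P a = Σ (Fin a → Fin k) λ g → StrictlyIncreasing g × (∀ i → P (g i))

module _ {k} {P : Fin (suc k) → Set} where

  selection-shift : ∀ {a} → Selection (P ∘ suc) a → Selection P a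
  selection-shift (g , g-increasing , p) = suc ∘ g , (λ i j i<j → s≤s (g-increasing i j i<j)) , p

  selection-cons : ∀ {a} → P zero → Selection (P ∘ suc) a → Selection P (suc a)
  selection-cons {a} p₀ (g , g-increasing , p) = g′ , g′-increasing , p′
    where
    g′ : Fin (suc a) → Fin (suc k)
    g′ zero    = zero
    g′ (suc i) = suc (g i)
    g′-increasing : StrictlyIncreasing g′
    g′-increasing zero    (suc j) _         = s≤s z≤n
    g′-increasing (suc i) (suc j) (s≤s i<j) = s≤s (g-increasing i j i<j)
    p′ : ∀ i → P (g′ i)
    p′ zero    = p₀
    p′ (suc i) = p i

pigeonhole : ∀ {k} a b → a + b ≤ suc k → {P Q : Fin k → Set}
  → (∀ j → P j ⊎ Q j) → Selection P a ⊎ Selection Q b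
pigeonhole zero    b       _ _ = inj₁ ((λ ()) , (λ ()) , (λ ()))
pigeonhole (suc a) zero    _ _ = inj₂ ((λ ()) , (λ ()) , (λ ()))
pigeonhole {zero} (suc a) (suc b) (s≤s a+1+b≤0) _ with m+n≤o⇒n≤o a a+1+b≤0
... | ()
pigeonhole {suc k} (suc a) (suc b) (s≤s a+1+b≤1+k) {P} {Q} pq with pq zero
... | inj₁ p = map (selection-cons {P = P} p) (selection-shift {P = Q})
  (pigeonhole a (suc b) a+1+b≤1+k (pq ∘ suc))
... | inj₂ q = map (selection-shift {P = P}) (selection-cons {P = Q} q)
  (pigeonhole (suc a) b (subst (_≤ suc k) (+-suc a b) a+1+b≤1+k) (pq ∘ suc))

copies-monoCopy : ∀ {s t k a} d {π : Perm s} {σ : Perm t} → Bounded π → Bounded σ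
  → (c : Fin (k * s) → Bool) (col : Bool)
  → Selection (λ j → MonoCopy (patternOf π) (c ∘ combine j) col (patternOf σ)) a
  → MonoCopy (patternOf (copies d k π)) c col (patternOf (copies d a σ))
copies-monoCopy {s} {t} {k} {a} d {π} {σ} π-bounded σ-bounded c col (g , g-increasing , copy) =
  f , f-increasing , f-colour , f-pattern
  where
  h : Fin a → Fin t → Fin s
  h i = proj₁ (copy i)

  h-increasing : ∀ i → StrictlyIncreasing (h i)
  h-increasing i = proj₁ (proj₂ (copy i))

  h-colour : ∀ i x → c (combine (g i) (h i x)) ≡ col
  h-colour i = proj₁ (proj₂ (proj₂ (copy i)))

  h-pattern : ∀ i x y → patternOf π (h i x) (h i y) ≡ patternOf σ x y
  h-pattern i = proj₂ (proj₂ (proj₂ (copy i)))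

  embed : Fin a → Fin t → Fin (k * s)
  embed i x = combine (g i) (h i x)

  f : Fin (a * t) → Fin (k * s)
  f = uncurry embed ∘ remQuot t

  embed-increasing : ∀ {i j x y} → combine i x <ꟳ combine j y → embed i x <ꟳ embed j y
  embed-increasing {i} {j} {x} {y} lt with combine-<-lex lt
  ... | inj₁ i<j = combine-monoˡ-< (h i x) (h j y) (g-increasing i j i<j)
  ... | inj₂ (refl , x<y) = combine-monoʳ-< (g i) (h-increasing i x y x<y)

  embed-pattern : ∀ i j x y → patternOf (copies d k π) (embed i x) (embed j y)
                            ≡ patternOf (copies d a σ) (combine i x) (combine j y)
  embed-pattern i j x y with <-cmp i j
  ... | tri< i<j _ _ = trans (copies-pattern-before π π-bounded d k _ _ (g-increasing i j i<j))
                             (sym (copies-pattern-before σ σ-bounded d a x y i<j))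
  ... | tri> _ _ j<i = trans (copies-pattern-after π π-bounded d k _ _ (g-increasing j i j<i))
                             (sym (copies-pattern-after σ σ-bounded d a x y j<i))
  ... | tri≈ _ refl _ = begin
    patternOf (copies d k π) (embed i x) (embed i y) ≡⟨ copies-pattern-within π π-bounded d k (g i) _ _ ⟩
    patternOf π (h i x) (h i y)                      ≡⟨ h-pattern i x y ⟩
    patternOf σ x y                                  ≡⟨ copies-pattern-within σ σ-bounded d a i x y ⟨
    patternOf (copies d a σ) (combine i x) (combine i y) ∎
    where open ≡-Reasoning

  f-increasing : StrictlyIncreasing f
  f-increasing z z' lt =
    embed-increasing (subst₂ _<ꟳ_ (sym (combine-remQuot {a} t z)) (sym (combine-remQuot {a} t z')) lt)

  f-colour : ∀ z → c (f z) ≡ col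
  f-colour z = h-colour (quotient {a} t z) (remainder {a} t z)

  f-pattern : ∀ z z' → restrict (patternOf (copies d k π)) f z z' ≡ patternOf (copies d a σ) z z'
  f-pattern z z' = trans (embed-pattern _ _ _ _)
    (cong₂ (patternOf (copies d a σ)) (combine-remQuot {a} t z) (combine-remQuot {a} t z'))

fractal-suc : ∀ k n → fractal k (suc n) ≡ copies (isEven n) k (fractal k n)
fractal-suc k n with isEven n
... | true  = refl
... | false = refl

fractal-bounded : ∀ k n → Bounded (fractal k n)
fractal-bounded k zero    _ = s≤s z≤n
fractal-bounded k (suc n) rewrite fractal-suc k n =
  copies-bounded (fractal k n) (fractal-bounded k n) (isEven n) k

singleton-monoCopy : ∀ (c : Fin 1 → Bool) {col} → c zero ≡ col
  → MonoCopy (patternOf single) c col (patternOf single)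
singleton-monoCopy c c₀≡col = (λ x → x) , (λ _ _ x<y → x<y) , (λ { zero → c₀≡col }) , (λ _ _ → refl)

fractal-ramsey : ∀ {k} a b → a + b ≤ suc k → ∀ n (c : Fin (k ^ n) → Bool)
  → MonoCopy (patternOf (fractal k n)) c false (patternOf (fractal a n))
  ⊎ MonoCopy (patternOf (fractal k n)) c true (patternOf (fractal b n))
fractal-ramsey a b a+b≤1+k zero c with c zero in c₀
... | false = inj₁ (singleton-monoCopy c c₀)
... | true  = inj₂ (singleton-monoCopy c c₀)
fractal-ramsey {k} a b a+b≤1+k (suc n) c
  rewrite fractal-suc k n | fractal-suc a n | fractal-suc b n =
  map (copies-monoCopy (isEven n) (fractal-bounded k n) (fractal-bounded a n) c false)
      (copies-monoCopy (isEven n) (fractal-bounded k n) (fractal-bounded b n) c true)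
      (pigeonhole a b a+b≤1+k (λ j → fractal-ramsey a b a+b≤1+k n (c ∘ combine j)))

-- The pigeonhole step only needs a + b ≤ k + 1.
lemma4p6 : (a b : ℕ) → 1 ≤ a → 1 ≤ b → (n : ℕ)
    → (c : Fin ((a + b ∸ 1) ^ n) → Bool)
    → MonoCopy (patternOf (fractal (a + b ∸ 1) n)) c false (patternOf (fractal a n))
    ⊎ MonoCopy (patternOf (fractal (a + b ∸ 1) n)) c true (patternOf (fractal b n))
lemma4p6 (suc a) b (s≤s z≤n) _ = fractal-ramsey (suc a) b ≤-refl
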